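{- Let $m$ and $s$ be positive integers such that $m$ is a multiple of $3$. Then there is no balanced arithmetic tetrahedron of size $s$ in $\mathbb{Z}/m\mathbb{Z}$, i.e., for all $a,d_1,d_2,d_3\in\mathbb{Z}/m\mathbb{Z}$ the multiset $\mathrm{AS}(a,(d_1,d_2,d_3),s)$ is not balanced.
   Context: $\mathrm{AS}(a,(d_1,d_2,d_3),s)=\{a+i_1d_1+i_2d_2+i_3d_3: i\in\mathbb{N}^3,\ i_1+i_2+i_3\le s-1\}$ as a multiset of $\mathbb{Z}/m\mathbb{Z}$. A multiset is balanced if every element of $\mathbb{Z}/m\mathbb{Z}$ occurs in it with the same multiplicity. -}

module Defs where

open import Data.Nat using (ℕ; zero; suc; _+_; _*_; _∸_; _≤ᵇ_; NonZero)
open import Data.Nat.DivMod using (_%_)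
open import Data.Bool using (Bool; true; false; _∧_)
open import Data.Fin using (Fin; toℕ)
open import Data.List using (List; upTo; length; filter; concatMap; map; _∷_; [])
open import Data.Product using (_×_; _,_)
open import Relation.Binary.PropositionalEquality using (_≡_)
open import Data.Nat using (_≡ᵇ_)
open import Relation.Nullary.Decidable using (Dec)
open import Relation.Nullary using (yes; no)

-- Z/mZ is represented by Fin m (residues 0..m-1); arithmetic is done on
-- natural-number representatives and reduced mod m.

indexTriples : ℕ → List (ℕ × ℕ × ℕ)
indexTriples s =
  concatMap (λ i₁ →
    concatMap (λ i₂ →
      map (λ i₃ → (i₁ , i₂ , i₃))
          (filter (λ i₃ → suc (i₁ + i₂ + i₃) Data.Nat.≤? s) (upTo s)))
      (upTo s))
    (upTo s)

AS : (m : ℕ) → .{{NonZero m}} → Fin m → Fin m → Fin m → Fin m → ℕ → List ℕ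
AS m a d₁ d₂ d₃ s =
  map (λ { (i₁ , i₂ , i₃) →
           (toℕ a + i₁ * toℕ d₁ + i₂ * toℕ d₂ + i₃ * toℕ d₃) % m })
      (indexTriples s)

multiplicity : (m : ℕ) → .{{NonZero m}} → Fin m → Fin m → Fin m → Fin m → ℕ → Fin m → ℕ
multiplicity m a d₁ d₂ d₃ s x =
  length (filter (λ y → y Data.Nat.≟ toℕ x) (AS m a d₁ d₂ d₃ s))

Balanced : (m : ℕ) → .{{NonZero m}} → Fin m → Fin m → Fin m → Fin m → ℕ → Set
Balanced m a d₁ d₂ d₃ s =
  ∀ (x y : Fin m) → multiplicity m a d₁ d₂ d₃ s x ≡ multiplicity m a d₁ d₂ d₃ s y

-- If 3 ∣ m, a balanced multiset over ℤ/mℤ meets the three residue classes modulo 3 equally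
-- often. The number of points of AS(a,(d₁,d₂,d₃),s) in the class r mod 3 depends only on the
-- residues of a and the dᵢ, and along s = 3Q + e with e ∈ {1,2,3} it is a cubic
-- ∑ₖ (Q choose k) cₖ in Q: enlarging a simplex by 3 adds a layer whose count, by periodicity of
-- each direction, is a polynomial of lower degree in Q. Checking the 3⁵ residue patterns of
-- (d₁,d₂,d₃,e,a) shows that in each case the coefficient vector of one class dominates that of
-- another, strictly in the constant term, so the class sizes always differ.

module Submission where

open import Data.Bool using (true; false; if_then_else_)
open import Data.Fin as Fin using (Fin; toℕ; fromℕ<)
open import Data.Fin.Properties using (toℕ-fromℕ<; toℕ<n; all?; any?)
open import Data.List using (List; []; _∷_; _++_; map; concatMap; filter; length; applyUpTo; upTo)
open import Data.List.Properties using (map-++; map-∘; map-cong; map-cong-local)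
open import Data.List.Relation.Unary.All as All using (All)
open import Data.List.Relation.Unary.All.Properties as All using (map⁺)
open import Data.Nat using (ℕ; zero; suc; _+_; _*_; _∸_; _≤_; _<_; z≤n; s≤s; NonZero)
open import Data.Nat using (_≟_; _<?_; _≤?_; _≡ᵇ_; _<ᵇ_)
open import Data.Nat.DivMod using (_%_; _/_; _mod_; m%n<n; m%n%n≡m%n; m≡m%n+[m/n]*n; m<n⇒m%n≡m)
open import Data.Nat.DivMod using (%-distribˡ-+; %-distribˡ-*; [m+kn]%n≡m%n; %-remove-+ˡ; m∣n⇒o%n%m≡o%m)
open import Data.Nat.Divisibility using (_∣_; divides; ∣-refl)
open import Data.Nat.ListAction using (sum)
open import Data.Nat.ListAction.Properties using (sum-++)
open import Data.Nat.Properties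
open import Algebra.Properties.CommutativeSemigroup +-commutativeSemigroup
  using () renaming (interchange to +-interchange)
open import Data.Nat.Tactic.RingSolver using (solve-∀)
open import Data.Product using (_×_; _,_; ∃₂; uncurry)
open import Data.Vec.Functional as Vec using (Vector; head; tail)
open import Function using (_∘_; id)
open import Relation.Binary.PropositionalEquality
open import Relation.Nullary using (¬_; Dec; does; yes; no)
open import Relation.Nullary.Decidable using (dec-false; from-yes; _×-dec_; map′)

open import Defs using (indexTriples; AS; multiplicity; Balanced)

∑< : ℕ → (ℕ → ℕ) → ℕ
∑< zero    f = 0
∑< (suc n) f = f 0 + ∑< n (f ∘ suc)

syntax ∑< n (λ i → f) = ∑[ i < n ] f

∑-cong : ∀ n {f g : ℕ → ℕ} → (∀ i → i < n → f i ≡ g i) → ∑< n f ≡ ∑< n g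
∑-cong zero    eq = refl
∑-cong (suc n) eq = cong₂ _+_ (eq 0 (s≤s z≤n)) (∑-cong n (λ i i<n → eq (suc i) (s≤s i<n)))

∑-zero : ∀ n {f : ℕ → ℕ} → (∀ i → f i ≡ 0) → ∑< n f ≡ 0
∑-zero zero    eq = refl
∑-zero (suc n) eq = cong₂ _+_ (eq 0) (∑-zero n (eq ∘ suc))

∑-const : ∀ n k → ∑[ i < n ] k ≡ n * k
∑-const zero    k = refl
∑-const (suc n) k = cong (k +_) (∑-const n k)

∑-split : ∀ m n f → ∑< (m + n) f ≡ ∑< m f + ∑[ i < n ] f (m + i)
∑-split zero    n f = refl
∑-split (suc m) n f = trans (cong (f 0 +_) (∑-split m n (f ∘ suc))) (sym (+-assoc (f 0) _ _))

∑-last : ∀ n f → ∑< (suc n) f ≡ ∑< n f + f n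
∑-last zero    f = +-identityʳ (f 0)
∑-last (suc n) f = trans (cong (f 0 +_) (∑-last n (f ∘ suc))) (sym (+-assoc (f 0) _ _))

∑-distrib-+ : ∀ n f g → ∑[ i < n ] (f i + g i) ≡ ∑< n f + ∑< n g
∑-distrib-+ zero    f g = refl
∑-distrib-+ (suc n) f g = trans (cong (f 0 + g 0 +_) (∑-distrib-+ n (f ∘ suc) (g ∘ suc)))
                                (+-interchange (f 0) (g 0) _ _)

∑-mono-≤ : ∀ n {f g : ℕ → ℕ} → (∀ i → f i ≤ g i) → ∑< n f ≤ ∑< n g
∑-mono-≤ zero    le = z≤n
∑-mono-≤ (suc n) le = +-mono-≤ (le 0) (∑-mono-≤ n (le ∘ suc))

∑-shrink : ∀ k n {f : ℕ → ℕ} → k ≤ n → (∀ i → k ≤ i → f i ≡ 0) → ∑< n f ≡ ∑< k f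
∑-shrink zero    n       k≤n       vanish = ∑-zero n (λ i → vanish i z≤n)
∑-shrink (suc k) (suc n) (s≤s k≤n) vanish =
  cong (_ +_) (∑-shrink k n k≤n (λ i k≤i → vanish (suc i) (s≤s k≤i)))

∑-below : ∀ {k n} f → k ≤ n → ∑[ i < n ] (if i <ᵇ k then f i else 0) ≡ ∑< k f
∑-below {zero}  {n}     f k≤n       = ∑-zero n (λ _ → refl)
∑-below {suc k} {suc n} f (s≤s k≤n) = cong (f 0 +_) (∑-below (f ∘ suc) k≤n)

<ᵇ-∸ : ∀ c i n → (c + i <ᵇ n) ≡ (i <ᵇ n ∸ c)
<ᵇ-∸ zero    i n       = refl
<ᵇ-∸ (suc c) i zero    = refl
<ᵇ-∸ (suc c) i (suc n) = <ᵇ-∸ c i n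

-- does (suc (c + i) ≤? n) computes to c + i <ᵇ n: this is the filter in indexTriples.
∑-cut : ∀ n c f → ∑[ i < n ] (if c + i <ᵇ n then f i else 0) ≡ ∑< (n ∸ c) f
∑-cut n c f = trans (∑-cong n (λ i _ → cong (λ t → if t then f i else 0) (<ᵇ-∸ c i n)))
                    (∑-below f (m∸n≤m n c))

indicator : ∀ {p} {P : Set p} → Dec P → ℕ
indicator P? = if does P? then 1 else 0

indicator-≢ : ∀ a b → a ≢ b → indicator (a ≟ b) ≡ 0
indicator-≢ a b a≢b = cong (λ t → if t then 1 else 0) (dec-false (a ≟ b) a≢b)

≡ᵇ-cancelˡ : ∀ k a b → (k + a ≡ᵇ k + b) ≡ (a ≡ᵇ b)
≡ᵇ-cancelˡ zero    a b = refl
≡ᵇ-cancelˡ (suc k) a b = ≡ᵇ-cancelˡ k a b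

sum-map-++ : ∀ {A : Set} (f : A → ℕ) xs ys → sum (map f (xs ++ ys)) ≡ sum (map f xs) + sum (map f ys)
sum-map-++ f xs ys = trans (cong sum (map-++ f xs ys)) (sum-++ (map f xs) (map f ys))

sum-map-concatMap : ∀ {A B : Set} (f : B → ℕ) (g : A → List B) xs →
  sum (map f (concatMap g xs)) ≡ sum (map (λ x → sum (map f (g x))) xs)
sum-map-concatMap f g []       = refl
sum-map-concatMap f g (x ∷ xs) =
  trans (sum-map-++ f (g x) (concatMap g xs)) (cong (sum (map f (g x)) +_) (sum-map-concatMap f g xs))

sum-map-filter : ∀ {A : Set} {P : A → Set} (P? : ∀ x → Dec (P x)) (f : A → ℕ) xs →
  sum (map f (filter P? xs)) ≡ sum (map (λ x → if does (P? x) then f x else 0) xs)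
sum-map-filter P? f []       = refl
sum-map-filter P? f (x ∷ xs) with does (P? x)
... | true  = cong (f x +_) (sum-map-filter P? f xs)
... | false = sum-map-filter P? f xs

length-filter-indicator : ∀ {A : Set} {P : A → Set} (P? : ∀ x → Dec (P x)) xs →
  length (filter P? xs) ≡ sum (map (λ x → indicator (P? x)) xs)
length-filter-indicator P? []       = refl
length-filter-indicator P? (x ∷ xs) with does (P? x)
... | true  = cong suc (length-filter-indicator P? xs)
... | false = length-filter-indicator P? xs

sum-map-applyUpTo : ∀ {A : Set} (f : A → ℕ) (g : ℕ → A) n →
  sum (map f (applyUpTo g n)) ≡ ∑[ i < n ] f (g i)
sum-map-applyUpTo f g zero    = refl
sum-map-applyUpTo f g (suc n) = cong (f (g 0) +_) (sum-map-applyUpTo f (g ∘ suc) n)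

sum-map-∑ : ∀ {A : Set} J (f : ℕ → A → ℕ) xs →
  sum (map (λ x → ∑[ j < J ] f j x) xs) ≡ ∑[ j < J ] sum (map (f j) xs)
sum-map-∑ J f []       = sym (∑-zero J (λ _ → refl))
sum-map-∑ J f (x ∷ xs) =
  trans (cong (∑[ j < J ] f j x +_) (sum-map-∑ J f xs))
        (sym (∑-distrib-+ J (λ j → f j x) (λ j → sum (map (f j) xs))))

sum-indexTriples : ∀ s (f : ℕ × ℕ × ℕ → ℕ) → sum (map f (indexTriples s)) ≡
  ∑[ i₁ < s ] ∑[ i₂ < s ∸ i₁ ] ∑[ i₃ < s ∸ i₁ ∸ i₂ ] f (i₁ , i₂ , i₃)
sum-indexTriples s f = begin
  sum (map f (indexTriples s))
    ≡⟨ sum-map-concatMap f _ (upTo s) ⟩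
  sum (map (λ i₁ → sum (map f (concatMap (plane i₁) (upTo s)))) (upTo s))
    ≡⟨ sum-map-applyUpTo _ id s ⟩
  ∑[ i₁ < s ] sum (map f (concatMap (plane i₁) (upTo s)))
    ≡⟨ ∑-cong s (λ i₁ _ → trans (sum-map-concatMap f (plane i₁) (upTo s)) (sum-map-applyUpTo _ id s)) ⟩
  ∑[ i₁ < s ] ∑[ i₂ < s ] sum (map f (plane i₁ i₂))
    ≡⟨ ∑-cong s (λ i₁ _ → ∑-cong s (λ i₂ _ → line i₁ i₂)) ⟩
  ∑[ i₁ < s ] ∑[ i₂ < s ] ∑[ i₃ < s ∸ (i₁ + i₂) ] f (i₁ , i₂ , i₃)
    ≡⟨ ∑-cong s (λ i₁ _ → ∑-shrink (s ∸ i₁) s (m∸n≤m s i₁) (empty i₁)) ⟩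
  ∑[ i₁ < s ] ∑[ i₂ < s ∸ i₁ ] ∑[ i₃ < s ∸ (i₁ + i₂) ] f (i₁ , i₂ , i₃)
    ≡⟨ ∑-cong s (λ i₁ _ → ∑-cong (s ∸ i₁) (λ i₂ _ →
         cong (λ k → ∑[ i₃ < k ] f (i₁ , i₂ , i₃)) (∸-+-assoc s i₁ i₂))) ⟨
  ∑[ i₁ < s ] ∑[ i₂ < s ∸ i₁ ] ∑[ i₃ < s ∸ i₁ ∸ i₂ ] f (i₁ , i₂ , i₃)
    ∎
  where
  open ≡-Reasoning
  plane : ℕ → ℕ → List (ℕ × ℕ × ℕ)
  plane i₁ i₂ = map (λ i₃ → (i₁ , i₂ , i₃)) (filter (λ i₃ → suc (i₁ + i₂ + i₃) ≤? s) (upTo s))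
  line : ∀ i₁ i₂ → sum (map f (plane i₁ i₂)) ≡ ∑[ i₃ < s ∸ (i₁ + i₂) ] f (i₁ , i₂ , i₃)
  line i₁ i₂ = begin
    sum (map f (plane i₁ i₂))
      ≡⟨ cong sum (map-∘ (filter (λ i₃ → suc (i₁ + i₂ + i₃) ≤? s) (upTo s))) ⟨
    sum (map (λ i₃ → f (i₁ , i₂ , i₃)) (filter (λ i₃ → suc (i₁ + i₂ + i₃) ≤? s) (upTo s)))
      ≡⟨ sum-map-filter (λ i₃ → suc (i₁ + i₂ + i₃) ≤? s) _ (upTo s) ⟩
    sum (map (λ i₃ → if i₁ + i₂ + i₃ <ᵇ s then f (i₁ , i₂ , i₃) else 0) (upTo s))
      ≡⟨ sum-map-applyUpTo _ id s ⟩
    ∑[ i₃ < s ] (if i₁ + i₂ + i₃ <ᵇ s then f (i₁ , i₂ , i₃) else 0)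
      ≡⟨ ∑-cut s (i₁ + i₂) (λ i₃ → f (i₁ , i₂ , i₃)) ⟩
    ∑[ i₃ < s ∸ (i₁ + i₂) ] f (i₁ , i₂ , i₃)
      ∎
  empty : ∀ i₁ i₂ → s ∸ i₁ ≤ i₂ → ∑[ i₃ < s ∸ (i₁ + i₂) ] f (i₁ , i₂ , i₃) ≡ 0
  empty i₁ i₂ le rewrite sym (∸-+-assoc s i₁ i₂) | m≤n⇒m∸n≡0 le = refl

-- newton c Q = ∑ᵢ (Q choose i) * c i, defined through its forward differences.
newton : ∀ {k} → Vector ℕ k → ℕ → ℕ
newton {zero}  c Q = 0
newton {suc k} c Q = head c + ∑[ j < Q ] newton (tail c) j

newton-suc : ∀ {k} (c : Vector ℕ (suc k)) Q → newton c (suc Q) ≡ newton c Q + newton (tail c) Q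
newton-suc c Q = trans (cong (head c +_) (∑-last Q (newton (tail c)))) (sym (+-assoc (head c) _ _))

newton-telescope : ∀ {k} (F : ℕ → ℕ) (c : Vector ℕ k) →
  (∀ Q → F (suc Q) ≡ F Q + newton c Q) → ∀ Q → F Q ≡ newton (F 0 Vec.∷ c) Q
newton-telescope F c step zero    = sym (+-identityʳ (F 0))
newton-telescope F c step (suc Q) = begin
  F (suc Q)                           ≡⟨ step Q ⟩
  F Q + newton c Q                    ≡⟨ cong (_+ newton c Q) (newton-telescope F c step Q) ⟩
  newton (F 0 Vec.∷ c) Q + newton c Q ≡⟨ newton-suc (F 0 Vec.∷ c) Q ⟨
  newton (F 0 Vec.∷ c) (suc Q)        ∎
  where open ≡-Reasoning

newton-zero : ∀ k Q → newton {k} (λ _ → 0) Q ≡ 0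
newton-zero zero    Q = refl
newton-zero (suc k) Q = ∑-zero Q (newton-zero k)

newton-+ : ∀ {k} (c c′ : Vector ℕ k) Q → newton (λ i → c i + c′ i) Q ≡ newton c Q + newton c′ Q
newton-+ {zero}  c c′ Q = refl
newton-+ {suc k} c c′ Q = begin
  head c + head c′ + ∑[ j < Q ] newton (λ i → tail c i + tail c′ i) j
    ≡⟨ cong (head c + head c′ +_) (∑-cong Q (λ j _ → newton-+ (tail c) (tail c′) j)) ⟩
  head c + head c′ + ∑[ j < Q ] (newton (tail c) j + newton (tail c′) j)
    ≡⟨ cong (head c + head c′ +_) (∑-distrib-+ Q (newton (tail c)) (newton (tail c′))) ⟩
  head c + head c′ + (∑[ j < Q ] newton (tail c) j + ∑[ j < Q ] newton (tail c′) j)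
    ≡⟨ +-interchange (head c) (head c′) _ _ ⟩
  newton c Q + newton c′ Q
    ∎
  where open ≡-Reasoning

newton-∑ : ∀ {k} N (c : ℕ → Vector ℕ k) Q →
  newton (λ j → ∑[ i < N ] c i j) Q ≡ ∑[ i < N ] newton (c i) Q
newton-∑ {k} zero    c Q = newton-zero k Q
newton-∑     (suc N) c Q =
  trans (newton-+ (c 0) (λ j → ∑[ i < N ] c (suc i) j) Q) (cong (newton (c 0) Q +_) (newton-∑ N (c ∘ suc) Q))

newton-mono-≤ : ∀ {k} {c c′ : Vector ℕ k} → (∀ i → c i ≤ c′ i) → ∀ Q → newton c Q ≤ newton c′ Q
newton-mono-≤ {zero}  le Q = z≤n
newton-mono-≤ {suc k} le Q = +-mono-≤ (le Fin.zero) (∑-mono-≤ Q (newton-mono-≤ (le ∘ Fin.suc)))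

record Dominated {k} (c c′ : Vector ℕ (suc k)) : Set where
  constructor dominates
  field
    head< : head c < head c′
    tail≤ : ∀ i → tail c i ≤ tail c′ i

newton-mono-< : ∀ {k} {c c′ : Vector ℕ (suc k)} → Dominated c c′ → ∀ Q → newton c Q < newton c′ Q
newton-mono-< (dominates h< t≤) Q = +-mono-<-≤ h< (∑-mono-≤ Q (newton-mono-≤ t≤))

cone : ℕ → (ℕ → ℕ → ℕ) → ℕ → ℕ → ℕ
cone d F K b = ∑[ i < K ] F (K ∸ i) (b + i * d)

i*n+r<j*n : ∀ n {i j r} → i < j → r < n → i * n + r < j * n
i*n+r<j*n n {i} {j} {r} i<j r<n = begin-strict
  i * n + r   <⟨ +-monoʳ-< (i * n) r<n ⟩
  i * n + n   ≡⟨ +-comm (i * n) n ⟩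
  suc i * n   ≤⟨ *-monoˡ-≤ n i<j ⟩
  j * n       ∎
  where open ≤-Reasoning

module Modulo (n : ℕ) .{{_ : NonZero n}} where

  %-cong-+ : ∀ {a a′ b b′} → a % n ≡ a′ % n → b % n ≡ b′ % n → (a + b) % n ≡ (a′ + b′) % n
  %-cong-+ {a} {a′} {b} {b′} ea eb = begin
    (a + b) % n              ≡⟨ %-distribˡ-+ a b n ⟩
    (a % n + b % n) % n      ≡⟨ cong₂ (λ x y → (x + y) % n) ea eb ⟩
    (a′ % n + b′ % n) % n    ≡⟨ %-distribˡ-+ a′ b′ n ⟨
    (a′ + b′) % n            ∎
    where open ≡-Reasoning

  %-cong-*ˡ : ∀ i {d d′} → d % n ≡ d′ % n → (i * d) % n ≡ (i * d′) % n
  %-cong-*ˡ i {d} {d′} ed = begin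
    (i * d) % n              ≡⟨ %-distribˡ-* i d n ⟩
    (i % n * (d % n)) % n    ≡⟨ cong (λ x → (i % n * x) % n) ed ⟩
    (i % n * (d′ % n)) % n   ≡⟨ %-distribˡ-* i d′ n ⟨
    (i * d′) % n             ∎
    where open ≡-Reasoning

  CongMod : (F G : ℕ → ℕ → ℕ) → Set
  CongMod F G = ∀ K {b b′} → b % n ≡ b′ % n → F K b ≡ G K b′

  cone-congMod : ∀ {d d′ F G} → d % n ≡ d′ % n → CongMod F G → CongMod (cone d F) (cone d′ G)
  cone-congMod ed FG K eb = ∑-cong K (λ i _ → FG (K ∸ i) (%-cong-+ eb (%-cong-*ˡ i ed)))

  cone-layer : ∀ {F} d → CongMod F F → ∀ K b →
    cone d F (n + K) b ≡ ∑[ i < n ] F ((n + K) ∸ i) (b + i * d) + cone d F K b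
  cone-layer {F} d periodic K b =
    trans (∑-split n K _) (cong (∑[ i < n ] F ((n + K) ∸ i) (b + i * d) +_) (∑-cong K (λ i _ → shifted i)))
    where
    shifted : ∀ i → F ((n + K) ∸ (n + i)) (b + (n + i) * d) ≡ F (K ∸ i) (b + i * d)
    shifted i rewrite [m+n]∸[m+o]≡n∸o n K i = periodic (K ∸ i) (begin
      (b + (n + i) * d) % n        ≡⟨ cong (_% n) (regroup b n i d) ⟩
      (b + i * d + d * n) % n      ≡⟨ [m+kn]%n≡m%n (b + i * d) d n ⟩
      (b + i * d) % n              ∎)
      where
      open ≡-Reasoning
      regroup : ∀ b n i d → b + (n + i) * d ≡ b + i * d + d * n
      regroup = solve-∀

  HasNewton : ∀ k → (ℕ → ℕ → ℕ) → (ℕ → ℕ → Vector ℕ k) → Set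
  HasNewton k F c = ∀ Q e b → F (Q * n + e) b ≡ newton (c e b) Q

  coneCoeffs : ∀ {k} → ℕ → (ℕ → ℕ → ℕ) → (ℕ → ℕ → Vector ℕ k) → ℕ → ℕ → Vector ℕ (suc k)
  coneCoeffs d F c e b = cone d F e b Vec.∷ λ j → ∑[ i < n ] c ((n + e) ∸ i) (b + i * d) j

  -- Enlarging a cone by n adds n slices of F, and each slice is a Newton series of lower degree.
  cone-newton : ∀ {k F c} d → CongMod F F → HasNewton k F c → HasNewton (suc k) (cone d F) (coneCoeffs d F c)
  cone-newton {k} {F} {c} d periodic newtonF Q e b =
    newton-telescope (λ Q → cone d F (Q * n + e) b) layer step Q
    where
    layer : Vector ℕ k
    layer j = ∑[ i < n ] c ((n + e) ∸ i) (b + i * d) j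
    shift : ∀ Q i → i ≤ n → (n + (Q * n + e)) ∸ i ≡ Q * n + ((n + e) ∸ i)
    shift Q i i≤n = begin
      (n + (Q * n + e)) ∸ i    ≡⟨ cong (_∸ i) (regroup n Q e) ⟩
      (Q * n + (n + e)) ∸ i    ≡⟨ +-∸-assoc (Q * n) (≤-trans i≤n (m≤m+n n e)) ⟩
      Q * n + ((n + e) ∸ i)    ∎
      where
      open ≡-Reasoning
      regroup : ∀ n Q e → n + (Q * n + e) ≡ Q * n + (n + e)
      regroup = solve-∀
    step : ∀ Q → cone d F (suc Q * n + e) b ≡
                 cone d F (Q * n + e) b + newton layer Q
    step Q = begin
      cone d F (suc Q * n + e) b
        ≡⟨ cong (λ K → cone d F K b) (+-assoc n (Q * n) e) ⟩
      cone d F (n + (Q * n + e)) b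
        ≡⟨ cone-layer d periodic (Q * n + e) b ⟩
      ∑[ i < n ] F ((n + (Q * n + e)) ∸ i) (b + i * d) + cone d F (Q * n + e) b
        ≡⟨ cong (_+ _) (∑-cong n (λ i i<n →
             trans (cong (λ K → F K (b + i * d)) (shift Q i (<⇒≤ i<n))) (newtonF Q _ _))) ⟩
      ∑[ i < n ] newton (c ((n + e) ∸ i) (b + i * d)) Q + cone d F (Q * n + e) b
        ≡⟨ cong (_+ _) (newton-∑ n (λ i → c ((n + e) ∸ i) (b + i * d)) Q) ⟨
      newton layer Q + cone d F (Q * n + e) b
        ≡⟨ +-comm (newton layer Q) _ ⟩
      cone d F (Q * n + e) b + newton layer Q
        ∎
      where open ≡-Reasoning

  residueIndicator : ℕ → ℕ → ℕ → ℕ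
  residueIndicator r K b = indicator (b % n ≟ r)

  segmentCount : ℕ → ℕ → ℕ → ℕ → ℕ
  segmentCount r d₃ = cone d₃ (residueIndicator r)

  triangleCount : ℕ → ℕ → ℕ → ℕ → ℕ → ℕ
  triangleCount r d₂ d₃ = cone d₂ (segmentCount r d₃)

  -- tetrahedronCount r d₁ d₂ d₃ s a counts the points of AS(a,(d₁,d₂,d₃),s) that are ≡ r (mod n).
  tetrahedronCount : ℕ → ℕ → ℕ → ℕ → ℕ → ℕ → ℕ
  tetrahedronCount r d₁ d₂ d₃ = cone d₁ (triangleCount r d₂ d₃)

  residueCoeffs : ℕ → ℕ → ℕ → Vector ℕ 1
  residueCoeffs r e b = residueIndicator r e b Vec.∷ Vec.[]

  segmentCoeffs : ℕ → ℕ → ℕ → ℕ → Vector ℕ 2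
  segmentCoeffs r d₃ = coneCoeffs d₃ (residueIndicator r) (residueCoeffs r)

  triangleCoeffs : ℕ → ℕ → ℕ → ℕ → ℕ → Vector ℕ 3
  triangleCoeffs r d₂ d₃ = coneCoeffs d₂ (segmentCount r d₃) (segmentCoeffs r d₃)

  tetrahedronCoeffs : ℕ → ℕ → ℕ → ℕ → ℕ → ℕ → Vector ℕ 4
  tetrahedronCoeffs r d₁ d₂ d₃ = coneCoeffs d₁ (triangleCount r d₂ d₃) (triangleCoeffs r d₂ d₃)

  residueIndicator-congMod : ∀ r → CongMod (residueIndicator r) (residueIndicator r)
  residueIndicator-congMod r K eb = cong (λ x → indicator (x ≟ r)) eb

  tetrahedronCount-congMod : ∀ r {d₁ d₁′ d₂ d₂′ d₃ d₃′} →
    d₁ % n ≡ d₁′ % n → d₂ % n ≡ d₂′ % n → d₃ % n ≡ d₃′ % n →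
    CongMod (tetrahedronCount r d₁ d₂ d₃) (tetrahedronCount r d₁′ d₂′ d₃′)
  tetrahedronCount-congMod r e₁ e₂ e₃ =
    cone-congMod e₁ (cone-congMod e₂ (cone-congMod e₃ (residueIndicator-congMod r)))

  tetrahedronCount-newton : ∀ r d₁ d₂ d₃ →
    HasNewton 4 (tetrahedronCount r d₁ d₂ d₃) (tetrahedronCoeffs r d₁ d₂ d₃)
  tetrahedronCount-newton r d₁ d₂ d₃ =
    cone-newton {c = triangleCoeffs r d₂ d₃} d₁ (cone-congMod refl segment-periodic)
      (cone-newton {c = segmentCoeffs r d₃} d₂ segment-periodic
        (cone-newton {c = residueCoeffs r} d₃ (residueIndicator-congMod r) constant))
    where
    segment-periodic : CongMod (segmentCount r d₃) (segmentCount r d₃)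
    segment-periodic = cone-congMod refl (residueIndicator-congMod r)
    constant : HasNewton 1 (residueIndicator r) (residueCoeffs r)
    constant Q e b = sym (trans (cong (residueIndicator r e b +_) (∑-zero Q (λ _ → refl))) (+-identityʳ _))

  residue-indicator-split : ∀ J {r} → r < n → ∀ y → y < J * n →
    indicator (y % n ≟ r) ≡ ∑[ j < J ] indicator (y ≟ j * n + r)
  residue-indicator-split zero    r<n y ()
  residue-indicator-split (suc J) {r} r<n y y<Jn with y <? n
  ... | yes y<n = begin
    indicator (y % n ≟ r)   ≡⟨ cong (λ x → indicator (x ≟ r)) (m<n⇒m%n≡m y<n) ⟩
    indicator (y ≟ r)       ≡⟨ +-identityʳ _ ⟨
    indicator (y ≟ r) + 0   ≡⟨ cong (indicator (y ≟ r) +_) (∑-zero J missed) ⟨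
    indicator (y ≟ r) + ∑[ j < J ] indicator (y ≟ suc j * n + r) ∎
    where
    open ≡-Reasoning
    missed : ∀ j → indicator (y ≟ suc j * n + r) ≡ 0
    missed j = indicator-≢ y _ λ { refl → <⇒≱ y<n (≤-trans (m≤m+n n (j * n)) (m≤m+n _ r)) }
  ... | no y≮n with m≤n⇒∃[o]m+o≡n (≮⇒≥ y≮n)
  ...   | y′ , refl = begin
    indicator ((n + y′) % n ≟ r)
      ≡⟨ cong (λ x → indicator (x ≟ r)) (%-remove-+ˡ y′ (∣-refl {n})) ⟩
    indicator (y′ % n ≟ r)
      ≡⟨ residue-indicator-split J r<n y′ (+-cancelˡ-< n y′ (J * n) y<Jn) ⟩
    ∑[ j < J ] indicator (y′ ≟ j * n + r)
      ≡⟨ ∑-cong J (λ j _ → shifted j) ⟩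
    ∑[ j < J ] indicator (n + y′ ≟ suc j * n + r)
      ≡⟨ cong (_+ ∑[ j < J ] indicator (n + y′ ≟ suc j * n + r)) missed ⟨
    indicator (n + y′ ≟ r) + ∑[ j < J ] indicator (n + y′ ≟ suc j * n + r)
      ∎
    where
    open ≡-Reasoning
    missed : indicator (n + y′ ≟ r) ≡ 0
    missed = indicator-≢ (n + y′) r λ eq → <⇒≱ r<n (≤-trans (m≤m+n n y′) (≤-reflexive eq))
    shifted : ∀ j → indicator (y′ ≟ j * n + r) ≡ indicator (n + y′ ≟ suc j * n + r)
    shifted j = cong (λ t → if t then 1 else 0)
      (trans (sym (≡ᵇ-cancelˡ n y′ (j * n + r))) (cong (n + y′ ≡ᵇ_) (sym (+-assoc n (j * n) r))))

  residueCount : ℕ → List ℕ → ℕ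
  residueCount r xs = length (filter (λ y → y % n ≟ r) xs)

  residueCount-uniform : ∀ J k {r} → r < n → ∀ xs → All (_< J * n) xs →
    (∀ t → t < J * n → length (filter (_≟ t) xs) ≡ k) → residueCount r xs ≡ J * k
  residueCount-uniform J k {r} r<n xs bounded uniform = begin
    residueCount r xs
      ≡⟨ length-filter-indicator (λ y → y % n ≟ r) xs ⟩
    sum (map (λ y → indicator (y % n ≟ r)) xs)
      ≡⟨ cong sum (map-cong-local (All.map (λ {y} → residue-indicator-split J r<n y) bounded)) ⟩
    sum (map (λ y → ∑[ j < J ] indicator (y ≟ j * n + r)) xs)
      ≡⟨ sum-map-∑ J (λ j y → indicator (y ≟ j * n + r)) xs ⟩
    ∑[ j < J ] sum (map (λ y → indicator (y ≟ j * n + r)) xs)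
      ≡⟨ ∑-cong J (λ j j<J → trans (sym (length-filter-indicator (_≟ j * n + r) xs))
                                   (uniform _ (i*n+r<j*n n j<J r<n))) ⟩
    ∑[ j < J ] k
      ≡⟨ ∑-const J k ⟩
    J * k
      ∎
    where open ≡-Reasoning

  residueCount-AS : ∀ m .{{_ : NonZero m}} → n ∣ m → ∀ r (a d₁ d₂ d₃ : Fin m) s →
    residueCount r (AS m a d₁ d₂ d₃ s) ≡ tetrahedronCount r (toℕ d₁) (toℕ d₂) (toℕ d₃) s (toℕ a)
  residueCount-AS m n∣m r a d₁ d₂ d₃ s = begin
    residueCount r (AS m a d₁ d₂ d₃ s)
      ≡⟨ length-filter-indicator (λ y → y % n ≟ r) (AS m a d₁ d₂ d₃ s) ⟩
    sum (map (λ y → indicator (y % n ≟ r)) (AS m a d₁ d₂ d₃ s))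
      ≡⟨ cong sum (map-∘ (indexTriples s)) ⟨
    sum (map (λ t → indicator (point t % m % n ≟ r)) (indexTriples s))
      ≡⟨ cong sum (map-cong (λ t → cong (λ x → indicator (x ≟ r)) (m∣n⇒o%n%m≡o%m n m (point t) n∣m))
                            (indexTriples s)) ⟩
    sum (map (λ t → indicator (point t % n ≟ r)) (indexTriples s))
      ≡⟨ sum-indexTriples s _ ⟩
    tetrahedronCount r (toℕ d₁) (toℕ d₂) (toℕ d₃) s (toℕ a)
      ∎
    where
    open ≡-Reasoning
    point : ℕ × ℕ × ℕ → ℕ
    point (i₁ , i₂ , i₃) = toℕ a + i₁ * toℕ d₁ + i₂ * toℕ d₂ + i₃ * toℕ d₃

  balanced⇒tetrahedronCount : ∀ m .{{_ : NonZero m}} (n∣m : n ∣ m) (a d₁ d₂ d₃ : Fin m) s →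
    Balanced m a d₁ d₂ d₃ s → ∀ x {r} → r < n →
    tetrahedronCount r (toℕ d₁) (toℕ d₂) (toℕ d₃) s (toℕ a) ≡
    _∣_.quotient n∣m * multiplicity m a d₁ d₂ d₃ s x
  balanced⇒tetrahedronCount m n∣m@(divides J m≡Jn) a d₁ d₂ d₃ s balanced x {r} r<n = begin
    tetrahedronCount r (toℕ d₁) (toℕ d₂) (toℕ d₃) s (toℕ a)
      ≡⟨ residueCount-AS m n∣m r a d₁ d₂ d₃ s ⟨
    residueCount r (AS m a d₁ d₂ d₃ s)
      ≡⟨ residueCount-uniform J _ r<n (AS m a d₁ d₂ d₃ s) bounded uniform ⟩
    J * multiplicity m a d₁ d₂ d₃ s x
      ∎
    where
    open ≡-Reasoning
    bounded : All (_< J * n) (AS m a d₁ d₂ d₃ s)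
    bounded = subst (λ k → All (_< k) (AS m a d₁ d₂ d₃ s)) m≡Jn
                (map⁺ (All.universal (λ { (i₁ , i₂ , i₃) → m%n<n _ m }) (indexTriples s)))
    uniform : ∀ t → t < J * n → length (filter (_≟ t) (AS m a d₁ d₂ d₃ s)) ≡ multiplicity m a d₁ d₂ d₃ s x
    uniform t t<Jn =
      trans (cong (λ u → length (filter (_≟ u) (AS m a d₁ d₂ d₃ s))) (sym (toℕ-fromℕ< t<m)))
            (balanced (fromℕ< t<m) x)
      where
      t<m : t < m
      t<m = subst (t <_) (sym m≡Jn) t<Jn

  toℕ-mod : ∀ x → toℕ (x mod n) ≡ x % n
  toℕ-mod x = toℕ-fromℕ< (m%n<n x n)

  suc-≡-div-mod : ∀ s → suc s ≡ s / n * n + suc (toℕ (s mod n))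
  suc-≡-div-mod s = begin
    suc s                              ≡⟨ cong suc (m≡m%n+[m/n]*n s n) ⟩
    suc (s % n) + s / n * n            ≡⟨ +-comm (suc (s % n)) (s / n * n) ⟩
    s / n * n + suc (s % n)            ≡⟨ cong (λ e → s / n * n + suc e) (toℕ-mod s) ⟨
    s / n * n + suc (toℕ (s mod n))    ∎
    where open ≡-Reasoning

  -- The offset is 1 + s mod n rather than (1 + s) mod n: at offset 0 and Q = 0 all counts vanish.
  tetrahedronCount-reduced : ∀ r d₁ d₂ d₃ s b → tetrahedronCount r d₁ d₂ d₃ (suc s) b ≡
    newton (tetrahedronCoeffs r (toℕ (d₁ mod n)) (toℕ (d₂ mod n)) (toℕ (d₃ mod n))
                              (suc (toℕ (s mod n))) (toℕ (b mod n))) (s / n)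
  tetrahedronCount-reduced r d₁ d₂ d₃ s b = begin
    tetrahedronCount r d₁ d₂ d₃ (suc s) b
      ≡⟨ tetrahedronCount-congMod r (reduce d₁) (reduce d₂) (reduce d₃) (suc s) (reduce b) ⟩
    tetrahedronCount r (ρ d₁) (ρ d₂) (ρ d₃) (suc s) (ρ b)
      ≡⟨ cong (λ K → tetrahedronCount r (ρ d₁) (ρ d₂) (ρ d₃) K (ρ b)) (suc-≡-div-mod s) ⟩
    tetrahedronCount r (ρ d₁) (ρ d₂) (ρ d₃) (s / n * n + suc (ρ s)) (ρ b)
      ≡⟨ tetrahedronCount-newton r (ρ d₁) (ρ d₂) (ρ d₃) (s / n) (suc (ρ s)) (ρ b) ⟩
    newton (tetrahedronCoeffs r (ρ d₁) (ρ d₂) (ρ d₃) (suc (ρ s)) (ρ b)) (s / n)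
      ∎
    where
    open ≡-Reasoning
    ρ : ℕ → ℕ
    ρ x = toℕ (x mod n)
    reduce : ∀ x → x % n ≡ ρ x % n
    reduce x = trans (sym (m%n%n≡m%n x n)) (cong (_% n) (sym (toℕ-mod x)))

open Modulo 3

dominated? : ∀ {k} (c c′ : Vector ℕ (suc k)) → Dec (Dominated c c′)
dominated? c c′ = map′ (uncurry dominates) (λ (dominates h< t≤) → h< , t≤)
  ((head c <? head c′) ×-dec all? (λ i → tail c i ≤? tail c′ i))

-- Opaque, so that the exhaustive decision is evaluated once rather than during later unification.
opaque
  residues-separated : ∀ (d₁ d₂ d₃ e b : Fin 3) → ∃₂ λ (r q : Fin 3) →
    Dominated (tetrahedronCoeffs (toℕ r) (toℕ d₁) (toℕ d₂) (toℕ d₃) (suc (toℕ e)) (toℕ b))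
              (tetrahedronCoeffs (toℕ q) (toℕ d₁) (toℕ d₂) (toℕ d₃) (suc (toℕ e)) (toℕ b))
  residues-separated = from-yes
    (all? λ (d₁ : Fin 3) → all? λ (d₂ : Fin 3) → all? λ (d₃ : Fin 3) →
     all? λ (e : Fin 3) → all? λ (b : Fin 3) →
     any? λ (r : Fin 3) → any? λ (q : Fin 3) →
     dominated? (tetrahedronCoeffs (toℕ r) (toℕ d₁) (toℕ d₂) (toℕ d₃) (suc (toℕ e)) (toℕ b))
                (tetrahedronCoeffs (toℕ q) (toℕ d₁) (toℕ d₂) (toℕ d₃) (suc (toℕ e)) (toℕ b)))

tetrahedronCounts-separated : ∀ d₁ d₂ d₃ s b → ∃₂ λ (r q : Fin 3) →
  tetrahedronCount (toℕ r) d₁ d₂ d₃ (suc s) b < tetrahedronCount (toℕ q) d₁ d₂ d₃ (suc s) b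
tetrahedronCounts-separated d₁ d₂ d₃ s b =
  let r , q , dominated = residues-separated (d₁ mod 3) (d₂ mod 3) (d₃ mod 3) (s mod 3) (b mod 3) in
  r , q , subst₂ _<_ (sym (tetrahedronCount-reduced (toℕ r) d₁ d₂ d₃ s b))
                     (sym (tetrahedronCount-reduced (toℕ q) d₁ d₂ d₃ s b))
                     (newton-mono-< dominated (s / 3))

theorem3p13 : (m s : ℕ) → .{{_ : NonZero m}} → 0 < s → 3 ∣ m →
    (a d₁ d₂ d₃ : Fin m) → ¬ Balanced m a d₁ d₂ d₃ s
theorem3p13 m zero    ()
theorem3p13 m (suc s) _ 3∣m a d₁ d₂ d₃ balanced =
  let r , q , r<q = tetrahedronCounts-separated (toℕ d₁) (toℕ d₂) (toℕ d₃) s (toℕ a) in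
  <-irrefl (trans (count r) (sym (count q))) r<q
  where
  count : ∀ r → tetrahedronCount (toℕ r) (toℕ d₁) (toℕ d₂) (toℕ d₃) (suc s) (toℕ a) ≡
                _∣_.quotient 3∣m * multiplicity m a d₁ d₂ d₃ (suc s) a
  count r = balanced⇒tetrahedronCount m 3∣m a d₁ d₂ d₃ (suc s) balanced a (toℕ<n r)
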